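{- Let $p>3$ be a prime. Define the rational number \[\gamma(p) = \sum_{r=1}^{p-1}\frac{(3p+1)!!!}{(3r+4)!!!}\left((3r+2)!!! + (3r+3)!!! + \sum_{n=1}^{r-1}\left(\frac{(3n+1)!!!\,(3r+2)!!!}{(3n+2)!!!} + \frac{(3n+1)!!!\,(3r+3)!!!}{(3n+3)!!!}\right)\right).\] Then $\gamma(p)$ has denominator prime to $p$ and $\gamma(p) \equiv 2 \pmod p$, i.e. $\gamma(p) = 2$ in $\mathbb{F}_p$.
   Context: The triple factorial $n!!!$ for integers $n \geq 0$ is defined by $0!!! = 1!!! = 2!!! = 1$ and $n!!! = n \cdot (n-3)!!!$ for $n \geq 3$. Empty sums (upper index smaller than lower index) are $0$. -}

module Defs where

open import Data.Nat using (ℕ; zero; suc; _+_; _*_; _∸_)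
open import Data.Integer using (+_)
open import Data.Rational using (ℚ; 0ℚ; _/_)
import Data.Rational as Q

_!!! : ℕ → ℕ
zero !!! = 1
suc zero !!! = 1
suc (suc zero) !!! = 1
suc (suc (suc n)) !!! = suc (suc (suc n)) * (n !!!)

-- a / b as a rational; only used with b a triple factorial (so b ≥ 1);
-- the b = 0 clause is never reached in the statement.
frac : ℕ → ℕ → ℚ
frac a zero = 0ℚ
frac a (suc b) = (+ a) / suc b

-- Σ_{i=lo}^{hi} f i  (empty, i.e. 0, when hi < lo)
sumFromTo : ℕ → ℕ → (ℕ → ℚ) → ℚ
sumFromTo lo hi f = go (suc hi ∸ lo)
  where
  go : ℕ → ℚ
  go zero = 0ℚ
  go (suc k) = f (lo + k) Q.+ go k

γ : ℕ → ℚ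
γ p = sumFromTo 1 (p ∸ 1) λ r →
  frac ((3 * p + 1) !!!) ((3 * r + 4) !!!) Q.*
    ( frac ((3 * r + 2) !!!) 1 Q.+ frac ((3 * r + 3) !!!) 1 Q.+
      sumFromTo 1 (r ∸ 1) λ n →
        frac ((3 * n + 1) !!! * (3 * r + 2) !!!) ((3 * n + 2) !!!) Q.+
        frac ((3 * n + 1) !!! * (3 * r + 3) !!!) ((3 * n + 3) !!!))

-- Clearing the triple-factorial denominators turns γ(p) into a natural number
-- Γ(p) = ∑_{r=1}^{p-1} ∏_{k=r+2}^{p} (3k + 1) · I(r), computed by Horner’s rule. The inner sums
-- I(r) satisfy first-order recurrences with explicit closed forms; substituting them, the weighted
-- sums telescope, and as p divides 3k₁ + 1 and 3k₂ + 2 for some k₁, k₂ < p, the boundary terms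
-- vanish modulo p. What remains is 2Γ(p) + 4H ≡ 0 (mod p) for
-- H = ∏_{k=1}^{p} (3k + 1) · ∑_{r=1}^{p-1} 1/(3r + 4). Modulo p every term of H but the one with
-- 3r + 4 = 3k₁ + 1 contains the factor 3k₁ + 1, and that term is
-- ∏_{k≠k₁} (3k + 1) ≡ ∏_{k≠k₁} 3(k - k₁) ≡ 3^{p-1} (p - 1)! ≡ -1 by Fermat and Wilson.
-- Hence 2Γ(p) ≡ 4, and Γ(p) ≡ 2 as p is odd.

module Submission where

open import Defs

module Ranges where

  open import Data.Nat using (ℕ; zero; suc; _+_; _*_; _≤_; _<_)
  open import Data.Nat.Properties
  open import Data.Nat.Divisibility using (_∣_; ∣-refl; _∣0; ∣m∣n⇒∣m+n; ∣m⇒∣m*n; ∣n⇒∣m*n)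
  open import Data.Sum using (inj₁; inj₂)
  open import Relation.Nullary using (contradiction)
  open import Relation.Binary.PropositionalEquality
  open import Data.Nat.Tactic.RingSolver using (solve-∀)

  ∑ : (ℕ → ℕ) → ℕ → ℕ → ℕ
  ∑ f i zero = 0
  ∑ f i (suc l) = ∑ f i l + f (i + l)

  ∏ : (ℕ → ℕ) → ℕ → ℕ → ℕ
  ∏ f i zero = 1
  ∏ f i (suc l) = ∏ f i l * f (i + l)

  ∑-cong : ∀ {f g : ℕ → ℕ} i l → (∀ k → i ≤ k → k < i + l → f k ≡ g k) → ∑ f i l ≡ ∑ g i l
  ∑-cong i zero eq = refl
  ∑-cong i (suc l) eq = cong₂ _+_
    (∑-cong i l λ k i≤k k<i+l → eq k i≤k (<-trans k<i+l (+-monoʳ-< i ≤-refl)))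
    (eq (i + l) (m≤m+n i l) (+-monoʳ-< i ≤-refl))

  ∑-+ : ∀ (f g : ℕ → ℕ) i l → ∑ (λ k → f k + g k) i l ≡ ∑ f i l + ∑ g i l
  ∑-+ f g i zero = refl
  ∑-+ f g i (suc l) = begin
    ∑ (λ k → f k + g k) i l + (f (i + l) + g (i + l))  ≡⟨ cong (_+ (f (i + l) + g (i + l))) (∑-+ f g i l) ⟩
    ∑ f i l + ∑ g i l + (f (i + l) + g (i + l))        ≡⟨ +-assoc-middle (∑ f i l) (∑ g i l) (f (i + l)) (g (i + l)) ⟩
    ∑ f i l + f (i + l) + (∑ g i l + g (i + l))        ∎
    where
    open ≡-Reasoning
    +-assoc-middle : ∀ a b c d → a + b + (c + d) ≡ a + c + (b + d)
    +-assoc-middle = solve-∀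

  ∑-*ˡ : ∀ c (f : ℕ → ℕ) i l → ∑ (λ k → c * f k) i l ≡ c * ∑ f i l
  ∑-*ˡ c f i zero = sym (*-zeroʳ c)
  ∑-*ˡ c f i (suc l) = trans (cong (_+ c * f (i + l)) (∑-*ˡ c f i l)) (sym (*-distribˡ-+ c _ _))

  ∑-cons : ∀ (f : ℕ → ℕ) i l → ∑ f i (suc l) ≡ f i + ∑ f (suc i) l
  ∑-cons f i zero = trans (+-identityˡ _) (trans (cong f (+-identityʳ i)) (sym (+-identityʳ _)))
  ∑-cons f i (suc l) = begin
    ∑ f i (suc l) + f (i + suc l)        ≡⟨ cong₂ _+_ (∑-cons f i l) (cong f (+-suc i l)) ⟩
    f i + ∑ f (suc i) l + f (suc i + l)  ≡⟨ +-assoc (f i) _ _ ⟩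
    f i + ∑ f (suc i) (suc l)            ∎
    where open ≡-Reasoning

  ∣-∑ : ∀ {d} {f : ℕ → ℕ} i l → (∀ k → i ≤ k → k < i + l → d ∣ f k) → d ∣ ∑ f i l
  ∣-∑ i zero d∣f = _ ∣0
  ∣-∑ i (suc l) d∣f = ∣m∣n⇒∣m+n
    (∣-∑ i l λ k i≤k k<i+l → d∣f k i≤k (<-trans k<i+l (+-monoʳ-< i ≤-refl)))
    (d∣f (i + l) (m≤m+n i l) (+-monoʳ-< i ≤-refl))

  ∏-+ : ∀ (f : ℕ → ℕ) i a b → ∏ f i (a + b) ≡ ∏ f i a * ∏ f (i + a) b
  ∏-+ f i a zero = trans (cong (∏ f i) (+-identityʳ a)) (sym (*-identityʳ _))
  ∏-+ f i a (suc b) = begin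
    ∏ f i (a + suc b)                          ≡⟨ cong (∏ f i) (+-suc a b) ⟩
    ∏ f i (a + b) * f (i + (a + b))            ≡⟨ cong₂ _*_ (∏-+ f i a b) (cong f (sym (+-assoc i a b))) ⟩
    ∏ f i a * ∏ f (i + a) b * f (i + a + b)    ≡⟨ *-assoc (∏ f i a) _ _ ⟩
    ∏ f i a * ∏ f (i + a) (suc b)              ∎
    where open ≡-Reasoning

  ∏-cons : ∀ (f : ℕ → ℕ) i l → ∏ f i (suc l) ≡ f i * ∏ f (suc i) l
  ∏-cons f i l = trans (∏-+ f i 1 l) (cong₂ _*_ (trans (*-identityˡ _) (cong f (+-identityʳ i))) (cong (λ j → ∏ f j l) (+-comm i 1)))

  ∣-∏ : ∀ (f : ℕ → ℕ) {i k} l → i ≤ k → k < i + l → f k ∣ ∏ f i l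
  ∣-∏ f {i} zero i≤k k<i+0 = contradiction k<i+0 (≤⇒≯ (subst (_≤ _) (sym (+-identityʳ i)) i≤k))
  ∣-∏ f {i} {k} (suc l) i≤k k<i+1+l with m≤n⇒m<n∨m≡n (≤-pred (subst (k <_) (+-suc i l) k<i+1+l))
  ... | inj₁ k<i+l = ∣m⇒∣m*n _ (∣-∏ f l i≤k k<i+l)
  ... | inj₂ refl = ∣n⇒∣m*n (∏ f i l) ∣-refl


module Binomials where

  open Ranges
  open import Data.Nat using (ℕ; zero; suc; _+_; _*_; _^_; _<_; s≤s)
  open import Data.Nat.Properties
  open import Data.Nat.Divisibility using (_∣_; ∣-refl; ∣⇒≤; ∣m⇒∣m*n)
  open import Data.Nat.Primality using (Prime; euclidsLemma)
  open import Data.Sum using (inj₁; inj₂)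
  open import Relation.Nullary using (contradiction)
  open import Relation.Binary.PropositionalEquality
  open import Data.Nat.Tactic.RingSolver using (solve-∀)

  binomial : ℕ → ℕ → ℕ
  binomial n zero = 1
  binomial zero (suc k) = 0
  binomial (suc n) (suc k) = binomial n k + binomial n (suc k)

  binomial-1 : ∀ n → binomial n 1 ≡ n
  binomial-1 zero = refl
  binomial-1 (suc n) = cong suc (binomial-1 n)

  binomial-> : ∀ n k → n < k → binomial n k ≡ 0
  binomial-> zero (suc k) n<k = refl
  binomial-> (suc n) (suc k) (s≤s n<k) =
    cong₂ _+_ (binomial-> n k n<k) (binomial-> n (suc k) (m<n⇒m<1+n n<k))

  binomial-diag : ∀ n → binomial n n ≡ 1
  binomial-diag zero = refl
  binomial-diag (suc n) = cong₂ _+_ (binomial-diag n) (binomial-> n (suc n) ≤-refl)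

  binomial-absorb : ∀ n k → suc k * binomial (suc n) (suc k) ≡ suc n * binomial n k
  binomial-absorb zero zero = refl
  binomial-absorb zero (suc k) = *-zeroʳ (2 + k)
  binomial-absorb (suc n) zero = trans (*-identityˡ _) (trans (cong suc (binomial-1 (suc n))) (sym (*-identityʳ _)))
  binomial-absorb (suc n) (suc k) = begin
    (2 + k) * (b₁ + b₂)                                      ≡⟨ spread b₁ b₂ k ⟩
    b₁ + suc k * b₁ + (2 + k) * b₂                           ≡⟨ cong₂ (λ x y → b₁ + x + y) (binomial-absorb n k) (binomial-absorb n (suc k)) ⟩
    b₁ + suc n * binomial n k + suc n * binomial n (suc k)   ≡⟨ collect (binomial n k) (binomial n (suc k)) n ⟩
    (2 + n) * b₁                                             ∎
    where
    open ≡-Reasoning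
    b₁ = binomial (suc n) (suc k)
    b₂ = binomial (suc n) (2 + k)
    spread : ∀ x y k → (2 + k) * (x + y) ≡ x + suc k * x + (2 + k) * y
    spread = solve-∀
    collect : ∀ a b n → (a + b) + suc n * a + suc n * b ≡ (2 + n) * (a + b)
    collect = solve-∀

  prime∣binomial : ∀ {p k} → Prime p → 0 < k → k < p → p ∣ binomial p k
  prime∣binomial {suc n} {suc k} p-prime _ k<p
    with euclidsLemma (suc k) _ p-prime (subst (suc n ∣_) (sym (binomial-absorb n k)) (∣m⇒∣m*n _ ∣-refl))
  ... | inj₁ p∣k = contradiction (∣⇒≤ p∣k) (<⇒≱ k<p)
  ... | inj₂ p∣b = p∣b

  binomialTerm : ℕ → ℕ → ℕ → ℕ
  binomialTerm a n k = binomial n k * a ^ k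

  binomialTerm-suc : ∀ a n l →
    ∑ (binomialTerm a (suc n)) 0 (suc l) ≡ a * ∑ (binomialTerm a n) 0 l + ∑ (binomialTerm a n) 0 (suc l)
  binomialTerm-suc a n zero = cong (_+ 1) (sym (*-zeroʳ a))
  binomialTerm-suc a n (suc l) = begin
    ∑ (binomialTerm a (suc n)) 0 (suc l) + (binomial n l + binomial n (suc l)) * (a * a ^ l)
      ≡⟨ cong (_+ (binomial n l + binomial n (suc l)) * (a * a ^ l)) (binomialTerm-suc a n l) ⟩
    a * S + (S + binomial n l * a ^ l) + (binomial n l + binomial n (suc l)) * (a * a ^ l)
      ≡⟨ regroup a S (binomial n l) (binomial n (suc l)) (a ^ l) ⟩
    a * (S + binomial n l * a ^ l) + (S + binomial n l * a ^ l + binomial n (suc l) * (a * a ^ l))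
      ∎
    where
    open ≡-Reasoning
    S = ∑ (binomialTerm a n) 0 l
    regroup : ∀ a s b c x → a * s + (s + b * x) + (b + c) * (a * x) ≡ a * (s + b * x) + (s + b * x + c * (a * x))
    regroup = solve-∀

  binomial-theorem : ∀ a n → (1 + a) ^ n ≡ ∑ (binomialTerm a n) 0 (suc n)
  binomial-theorem a zero = refl
  binomial-theorem a (suc n) = begin
    (1 + a) * (1 + a) ^ n                                     ≡⟨ cong ((1 + a) *_) (binomial-theorem a n) ⟩
    (1 + a) * S                                               ≡⟨ distrib S a ⟩
    a * S + S                                                 ≡⟨ cong (a * S +_) (sym (+-identityʳ S)) ⟩
    a * S + (S + 0)                                           ≡⟨ cong (λ b → a * S + (S + b)) (sym (cong (_* a ^ suc n) (binomial-> n (suc n) ≤-refl))) ⟩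
    a * S + ∑ (binomialTerm a n) 0 (2 + n)                    ≡⟨ sym (binomialTerm-suc a n (suc n)) ⟩
    ∑ (binomialTerm a (suc n)) 0 (2 + n)                      ∎
    where
    open ≡-Reasoning
    S = ∑ (binomialTerm a n) 0 (suc n)
    distrib : ∀ s a → (1 + a) * s ≡ a * s + s
    distrib = solve-∀

  binomial-theorem-ends : ∀ a n → (1 + a) ^ suc n ≡ 1 + a ^ suc n + ∑ (binomialTerm a (suc n)) 1 n
  binomial-theorem-ends a n = begin
    (1 + a) ^ suc n                    ≡⟨ binomial-theorem a (suc n) ⟩
    ∑ f 0 (suc n) + f (suc n)          ≡⟨ cong₂ _+_ (∑-cons f 0 n) (cong (_* a ^ suc n) (binomial-diag (suc n))) ⟩
    1 * 1 + M + 1 * a ^ suc n          ≡⟨ regroup M (a ^ suc n) ⟩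
    1 + a ^ suc n + M                  ∎
    where
    open ≡-Reasoning
    f = binomialTerm a (suc n)
    M = ∑ f 1 n
    regroup : ∀ m x → 1 * 1 + m + 1 * x ≡ 1 + x + m
    regroup = solve-∀


module TripleFactorials where

  open Ranges
  open import Data.Nat using (ℕ; zero; suc; _+_; _*_; _∸_; _≤_; _<_; s≤s; z≤n)
  open import Data.Nat.Properties
  open import Relation.Binary.PropositionalEquality
  open import Data.Nat.Tactic.RingSolver using (solve-∀)

  tri : ℕ → ℕ → ℕ
  tri s k = 3 * k + s

  tri∏ : ℕ → ℕ → ℕ
  tri∏ s r = ∏ (tri s) 1 r

  !!!-pos : ∀ n → 0 < n !!!
  !!!-pos zero = s≤s z≤n
  !!!-pos (suc zero) = s≤s z≤n
  !!!-pos (suc (suc zero)) = s≤s z≤n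
  !!!-pos (suc (suc (suc n))) = *-mono-≤ (s≤s (z≤n {n = 2 + n})) (!!!-pos n)

  !!!-tri∏ : ∀ s m → (3 * m + s) !!! ≡ s !!! * tri∏ s m
  !!!-tri∏ s zero = sym (*-identityʳ (s !!!))
  !!!-tri∏ s (suc m) = begin
    (3 * suc m + s) !!!                    ≡⟨ cong _!!! (cong (_+ s) (*-suc 3 m)) ⟩
    (3 + (3 * m + s)) * (3 * m + s) !!!    ≡⟨ cong ((3 + (3 * m + s)) *_) (!!!-tri∏ s m) ⟩
    (3 + (3 * m + s)) * (s !!! * tri∏ s m) ≡⟨ regroup m s (s !!!) (tri∏ s m) ⟩
    s !!! * (tri∏ s m * tri s (suc m))     ∎
    where
    open ≡-Reasoning
    regroup : ∀ m s f x → (3 + (3 * m + s)) * (f * x) ≡ f * (x * (3 * (1 + m) + s))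
    regroup = solve-∀

  !!!-split : ∀ s {n r} → n ≤ r → (3 * r + s) !!! ≡ (3 * n + s) !!! * ∏ (tri s) (suc n) (r ∸ n)
  !!!-split s {n} {r} n≤r = begin
    (3 * r + s) !!!                                     ≡⟨ !!!-tri∏ s r ⟩
    s !!! * ∏ (tri s) 1 r                               ≡⟨ cong (λ l → s !!! * ∏ (tri s) 1 l) (sym (m+[n∸m]≡n n≤r)) ⟩
    s !!! * ∏ (tri s) 1 (n + (r ∸ n))                   ≡⟨ cong (s !!! *_) (∏-+ (tri s) 1 n (r ∸ n)) ⟩
    s !!! * (tri∏ s n * ∏ (tri s) (suc n) (r ∸ n))      ≡⟨ *-assoc (s !!!) _ _ ⟨
    s !!! * tri∏ s n * ∏ (tri s) (suc n) (r ∸ n)        ≡⟨ cong (_* ∏ (tri s) (suc n) (r ∸ n)) (!!!-tri∏ s n) ⟨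
    (3 * n + s) !!! * ∏ (tri s) (suc n) (r ∸ n)         ∎
    where open ≡-Reasoning


module WeightedSums where

  open Ranges
  open TripleFactorials
  open import Data.Nat using (ℕ; zero; suc; _+_; _*_; _∸_; _≤_; _<_)
  open import Data.Nat.Properties
  open import Relation.Binary.PropositionalEquality
  open import Data.Nat.Tactic.RingSolver using (solve-∀)
  open import Function using (_∘_)

  weighted : (ℕ → ℕ) → (ℕ → ℕ) → ℕ → ℕ
  weighted g I zero = 0
  weighted g I (suc q) = g (2 + q) * weighted g I q + I (suc q)

  weighted-∑ : ∀ g I q → weighted g I q ≡ ∑ (λ n → ∏ g (2 + n) (q ∸ n) * I n) 1 q
  weighted-∑ g I zero = refl
  weighted-∑ g I (suc q) = begin
    g (2 + q) * weighted g I q + I (suc q)                                   ≡⟨ cong (λ w → g (2 + q) * w + I (suc q)) (weighted-∑ g I q) ⟩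
    g (2 + q) * ∑ (λ n → ∏ g (2 + n) (q ∸ n) * I n) 1 q + I (suc q)          ≡⟨ cong (_+ I (suc q)) (∑-*ˡ (g (2 + q)) _ 1 q) ⟨
    ∑ (λ n → g (2 + q) * (∏ g (2 + n) (q ∸ n) * I n)) 1 q + I (suc q)        ≡⟨ cong₂ _+_ (∑-cong 1 q extend) last ⟩
    ∑ (λ n → ∏ g (2 + n) (suc q ∸ n) * I n) 1 q + ∏ g (3 + q) (q ∸ q) * I (suc q) ∎
    where
    open ≡-Reasoning
    last : I (suc q) ≡ ∏ g (3 + q) (q ∸ q) * I (suc q)
    last = trans (sym (*-identityˡ (I (suc q)))) (cong (λ l → ∏ g (3 + q) l * I (suc q)) (sym (n∸n≡0 q)))
    extend : ∀ n → 1 ≤ n → n < 1 + q → g (2 + q) * (∏ g (2 + n) (q ∸ n) * I n) ≡ ∏ g (2 + n) (suc q ∸ n) * I n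
    extend n _ n<1+q = begin
      g (2 + q) * (∏ g (2 + n) (q ∸ n) * I n)           ≡⟨ sym (*-assoc (g (2 + q)) (∏ g (2 + n) (q ∸ n)) (I n)) ⟩
      g (2 + q) * ∏ g (2 + n) (q ∸ n) * I n             ≡⟨ cong (_* I n) (*-comm (g (2 + q)) _) ⟩
      ∏ g (2 + n) (q ∸ n) * g (2 + q) * I n             ≡⟨ cong (λ k → ∏ g (2 + n) (q ∸ n) * g k * I n) (cong (2 +_) (sym (m+[n∸m]≡n n≤q))) ⟩
      ∏ g (2 + n) (q ∸ n) * g (2 + (n + (q ∸ n))) * I n ≡⟨ cong (λ l → ∏ g (2 + n) l * I n) (sym (+-∸-assoc 1 n≤q)) ⟩
      ∏ g (2 + n) (suc q ∸ n) * I n                     ∎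
      where
      n≤q = ≤-pred n<1+q

  weighted-cong : ∀ g {I I′ : ℕ → ℕ} → (∀ r → I (suc r) ≡ I′ (suc r)) → ∀ q → weighted g I q ≡ weighted g I′ q
  weighted-cong g eq zero = refl
  weighted-cong g eq (suc q) = cong₂ (λ w i → g (2 + q) * w + i) (weighted-cong g eq q) (eq q)

  weighted-+ : ∀ g (I I′ : ℕ → ℕ) q → weighted g (λ r → I r + I′ r) q ≡ weighted g I q + weighted g I′ q
  weighted-+ g I I′ zero = refl
  weighted-+ g I I′ (suc q) = begin
    g (2 + q) * weighted g (λ r → I r + I′ r) q + (I (suc q) + I′ (suc q))
      ≡⟨ cong (λ w → g (2 + q) * w + (I (suc q) + I′ (suc q))) (weighted-+ g I I′ q) ⟩
    g (2 + q) * (weighted g I q + weighted g I′ q) + (I (suc q) + I′ (suc q))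
      ≡⟨ distrib (g (2 + q)) (weighted g I q) (weighted g I′ q) (I (suc q)) (I′ (suc q)) ⟩
    g (2 + q) * weighted g I q + I (suc q) + (g (2 + q) * weighted g I′ q + I′ (suc q)) ∎
    where
    open ≡-Reasoning
    distrib : ∀ x a b c d → x * (a + b) + (c + d) ≡ x * a + c + (x * b + d)
    distrib = solve-∀

  weighted-+₃ : ∀ g (I I′ I″ : ℕ → ℕ) q →
    weighted g (λ r → I r + I′ r + I″ r) q ≡ weighted g I q + weighted g I′ q + weighted g I″ q
  weighted-+₃ g I I′ I″ q =
    trans (weighted-+ g (λ r → I r + I′ r) I″ q) (cong (_+ weighted g I″ q) (weighted-+ g I I′ q))

  weighted-*ˡ : ∀ g c (I : ℕ → ℕ) q → weighted g (λ r → c * I r) q ≡ c * weighted g I q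
  weighted-*ˡ g c I zero = sym (*-zeroʳ c)
  weighted-*ˡ g c I (suc q) = begin
    g (2 + q) * weighted g (λ r → c * I r) q + c * I (suc q)   ≡⟨ cong (λ w → g (2 + q) * w + c * I (suc q)) (weighted-*ˡ g c I q) ⟩
    g (2 + q) * (c * weighted g I q) + c * I (suc q)           ≡⟨ distrib (g (2 + q)) c (weighted g I q) (I (suc q)) ⟩
    c * (g (2 + q) * weighted g I q + I (suc q))               ∎
    where
    open ≡-Reasoning
    distrib : ∀ x c w i → x * (c * w) + c * i ≡ c * (x * w + i)
    distrib = solve-∀

  ratioSum : ℕ → ℕ → ℕ
  ratioSum s r = weighted (tri s) (λ n → tri s (suc n) * tri∏ 1 n) (r ∸ 1)

  ratioSum-closedForm : ∀ s t → s + t ≡ 4 → ∀ r →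
    t * ratioSum s (suc r) + 4 * tri∏ s (suc r) ≡ tri s (suc r) * tri∏ 1 (suc r)
  ratioSum-closedForm s t s+t≡4 zero = base s t
    where
    base : ∀ s t → t * 0 + 4 * (1 * (3 * 1 + s)) ≡ (3 * 1 + s) * (1 * (3 * 1 + 1))
    base = solve-∀
  ratioSum-closedForm s t s+t≡4 (suc r) = begin
    t * (x * j + x * a) + 4 * (ps * x)         ≡⟨ regroup t x j a ps ⟩
    x * (t * j + 4 * ps) + t * (x * a)         ≡⟨ cong (λ z → x * z + t * (x * a)) (ratioSum-closedForm s t s+t≡4 r) ⟩
    x * (tri s (suc r) * a) + t * (x * a)      ≡⟨ collect x a r s t ⟩
    x * (a * (3 * (1 + r) + (s + t)))          ≡⟨ cong (λ u → x * (a * (3 * (1 + r) + u))) s+t≡4 ⟩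
    x * (a * (3 * (1 + r) + 4))                ≡⟨ shift x a r ⟩
    x * (a * tri 1 (2 + r))                    ∎
    where
    open ≡-Reasoning
    x = tri s (2 + r)
    j = ratioSum s (suc r)
    a = tri∏ 1 (suc r)
    ps = tri∏ s (suc r)
    regroup : ∀ t x j a ps → t * (x * j + x * a) + 4 * (ps * x) ≡ x * (t * j + 4 * ps) + t * (x * a)
    regroup = solve-∀
    collect : ∀ x a r s t → x * ((3 * (1 + r) + s) * a) + t * (x * a) ≡ x * (a * (3 * (1 + r) + (s + t)))
    collect = solve-∀
    shift : ∀ x a r → x * (a * (3 * (1 + r) + 4)) ≡ x * (a * (3 * (2 + r) + 1))
    shift = solve-∀

  weighted-tri∏-suc : ∀ q → weighted (tri 1) (λ r → tri∏ 1 (suc r)) q ≡ q * tri∏ 1 (suc q)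
  weighted-tri∏-suc zero = refl
  weighted-tri∏-suc (suc q) = begin
    tri 1 (2 + q) * weighted (tri 1) (λ r → tri∏ 1 (suc r)) q + a * tri 1 (2 + q)
      ≡⟨ cong (λ w → tri 1 (2 + q) * w + a * tri 1 (2 + q)) (weighted-tri∏-suc q) ⟩
    tri 1 (2 + q) * (q * a) + a * tri 1 (2 + q)
      ≡⟨ collect (tri 1 (2 + q)) q a ⟩
    suc q * (a * tri 1 (2 + q))
      ∎
    where
    open ≡-Reasoning
    a = tri∏ 1 (suc q)
    collect : ∀ x q a → x * (q * a) + a * x ≡ suc q * (a * x)
    collect = solve-∀

  -- u times the n-th summand is T (n + 1) - T n for T n = tri∏ (1 + u) n * ∏_{k=n+1}^{q+1} (3k + 1).
  weighted-tri∏ : ∀ u q → u * weighted (tri 1) (tri∏ (suc u)) q + (4 + u) * ∏ (tri 1) 2 q ≡ tri∏ (suc u) (suc q)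
  weighted-tri∏ u zero = base u
    where
    base : ∀ u → u * 0 + (4 + u) * 1 ≡ 1 * (3 * 1 + suc u)
    base = solve-∀
  weighted-tri∏ u (suc q) = begin
    u * (x * w + ps) + (4 + u) * (c * x)     ≡⟨ regroup u x w ps c ⟩
    x * (u * w + (4 + u) * c) + u * ps       ≡⟨ cong (λ z → x * z + u * ps) (weighted-tri∏ u q) ⟩
    x * ps + u * ps                          ≡⟨ collect ps q u ⟩
    ps * tri (suc u) (2 + q)                 ∎
    where
    open ≡-Reasoning
    x = tri 1 (2 + q)
    w = weighted (tri 1) (tri∏ (suc u)) q
    ps = tri∏ (suc u) (suc q)
    c = ∏ (tri 1) 2 q
    regroup : ∀ u x w ps c → u * (x * w + ps) + (4 + u) * (c * x) ≡ x * (u * w + (4 + u) * c) + u * ps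
    regroup = solve-∀
    collect : ∀ ps q u → (3 * (2 + q) + 1) * ps + u * ps ≡ ps * (3 * (2 + q) + suc u)
    collect = solve-∀

  -- Γ p is γ p with all the divisions of triple factorials carried out.
  innerSum : ℕ → ℕ
  innerSum r = tri∏ 2 r + 3 * tri∏ 3 r
    + ∑ (λ n → tri∏ 1 n * ∏ (tri 2) (suc n) (r ∸ n) + tri∏ 1 n * ∏ (tri 3) (suc n) (r ∸ n)) 1 (r ∸ 1)

  Γ : ℕ → ℕ
  Γ p = ∑ (λ r → ∏ (tri 1) (2 + r) (p ∸ suc r) * innerSum r) 1 (p ∸ 1)

  ratioSum-∑ : ∀ s r → ∑ (λ n → tri∏ 1 n * ∏ (tri s) (suc n) (r ∸ n)) 1 (r ∸ 1) ≡ ratioSum s r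
  ratioSum-∑ s zero = refl
  ratioSum-∑ s (suc r) = trans (∑-cong 1 r term) (sym (weighted-∑ (tri s) _ r))
    where
    term : ∀ n → 1 ≤ n → n < 1 + r →
           tri∏ 1 n * ∏ (tri s) (suc n) (suc r ∸ n) ≡ ∏ (tri s) (2 + n) (r ∸ n) * (tri s (suc n) * tri∏ 1 n)
    term n _ n<1+r = begin
      tri∏ 1 n * ∏ (tri s) (suc n) (suc r ∸ n)                    ≡⟨ cong (λ l → tri∏ 1 n * ∏ (tri s) (suc n) l) (+-∸-assoc 1 (≤-pred n<1+r)) ⟩
      tri∏ 1 n * ∏ (tri s) (suc n) (suc (r ∸ n))                  ≡⟨ cong (tri∏ 1 n *_) (∏-cons (tri s) (suc n) (r ∸ n)) ⟩
      tri∏ 1 n * (tri s (suc n) * ∏ (tri s) (2 + n) (r ∸ n))      ≡⟨ rotate (tri∏ 1 n) (tri s (suc n)) _ ⟩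
      ∏ (tri s) (2 + n) (r ∸ n) * (tri s (suc n) * tri∏ 1 n)      ∎
      where
      open ≡-Reasoning
      rotate : ∀ a x c → a * (x * c) ≡ c * (x * a)
      rotate = solve-∀

  bracket₂ bracket₃ : ℕ → ℕ
  bracket₂ r = tri∏ 2 r + ratioSum 2 r
  bracket₃ r = 3 * tri∏ 3 r + ratioSum 3 r

  innerSum-split : ∀ r → innerSum r ≡ bracket₂ r + bracket₃ r
  innerSum-split r = begin
    tri∏ 2 r + 3 * tri∏ 3 r + ∑ (λ n → f₂ n + f₃ n) 1 (r ∸ 1)
      ≡⟨ cong (tri∏ 2 r + 3 * tri∏ 3 r +_) (∑-+ f₂ f₃ 1 (r ∸ 1)) ⟩
    tri∏ 2 r + 3 * tri∏ 3 r + (∑ f₂ 1 (r ∸ 1) + ∑ f₃ 1 (r ∸ 1))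
      ≡⟨ cong₂ (λ a b → tri∏ 2 r + 3 * tri∏ 3 r + (a + b)) (ratioSum-∑ 2 r) (ratioSum-∑ 3 r) ⟩
    tri∏ 2 r + 3 * tri∏ 3 r + (ratioSum 2 r + ratioSum 3 r)
      ≡⟨ swap-middle (tri∏ 2 r) (3 * tri∏ 3 r) (ratioSum 2 r) (ratioSum 3 r) ⟩
    bracket₂ r + bracket₃ r
      ∎
    where
    open ≡-Reasoning
    f₂ f₃ : ℕ → ℕ
    f₂ n = tri∏ 1 n * ∏ (tri 2) (suc n) (r ∸ n)
    f₃ n = tri∏ 1 n * ∏ (tri 3) (suc n) (r ∸ n)
    swap-middle : ∀ a b c d → a + b + (c + d) ≡ a + c + (b + d)
    swap-middle = solve-∀

  Γ-split : ∀ q → Γ (suc q) ≡ weighted (tri 1) bracket₂ q + weighted (tri 1) bracket₃ q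
  Γ-split q = begin
    Γ (suc q)                                                ≡⟨ weighted-∑ (tri 1) innerSum q ⟨
    weighted (tri 1) innerSum q                              ≡⟨ weighted-cong (tri 1) (innerSum-split ∘ suc) q ⟩
    weighted (tri 1) (λ r → bracket₂ r + bracket₃ r) q       ≡⟨ weighted-+ (tri 1) bracket₂ bracket₃ q ⟩
    weighted (tri 1) bracket₂ q + weighted (tri 1) bracket₃ q ∎
    where open ≡-Reasoning

  bracket₂-closedForm : ∀ r → 2 * (bracket₂ (suc r) + tri∏ 2 (suc r) + tri∏ 1 (suc r)) ≡ tri∏ 1 (2 + r)
  bracket₂-closedForm r = begin
    2 * (ps + j + ps + a)                ≡⟨ regroup ps j a ⟩
    (2 * j + 4 * ps) + 2 * a             ≡⟨ cong (_+ 2 * a) (ratioSum-closedForm 2 2 refl r) ⟩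
    tri 2 (suc r) * a + 2 * a            ≡⟨ collect r a ⟩
    a * tri 1 (2 + r)                    ∎
    where
    open ≡-Reasoning
    ps = tri∏ 2 (suc r)
    j = ratioSum 2 (suc r)
    a = tri∏ 1 (suc r)
    regroup : ∀ ps j a → 2 * (ps + j + ps + a) ≡ (2 * j + 4 * ps) + 2 * a
    regroup = solve-∀
    collect : ∀ r a → (3 * suc r + 2) * a + 2 * a ≡ a * (3 * (2 + r) + 1)
    collect = solve-∀

  bracket₃-closedForm : ∀ r → bracket₃ (suc r) + tri∏ 3 (suc r) + tri∏ 1 (suc r) ≡ tri∏ 1 (2 + r)
  bracket₃-closedForm r = begin
    3 * ps + j + ps + a                  ≡⟨ regroup ps j a ⟩
    (1 * j + 4 * ps) + a                 ≡⟨ cong (_+ a) (ratioSum-closedForm 3 1 refl r) ⟩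
    tri 3 (suc r) * a + a                ≡⟨ collect r a ⟩
    a * tri 1 (2 + r)                    ∎
    where
    open ≡-Reasoning
    ps = tri∏ 3 (suc r)
    j = ratioSum 3 (suc r)
    a = tri∏ 1 (suc r)
    regroup : ∀ ps j a → 3 * ps + j + ps + a ≡ (1 * j + 4 * ps) + a
    regroup = solve-∀
    collect : ∀ r a → (3 * suc r + 3) * a + a ≡ a * (3 * (2 + r) + 1)
    collect = solve-∀

  weighted-bracket₂ : ∀ q →
    2 * (weighted (tri 1) bracket₂ q + weighted (tri 1) (tri∏ 2) q + weighted (tri 1) (tri∏ 1) q) ≡ q * tri∏ 1 (suc q)
  weighted-bracket₂ q = begin
    2 * (weighted (tri 1) bracket₂ q + weighted (tri 1) (tri∏ 2) q + weighted (tri 1) (tri∏ 1) q)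
      ≡⟨ cong (2 *_) (weighted-+₃ (tri 1) bracket₂ (tri∏ 2) (tri∏ 1) q) ⟨
    2 * weighted (tri 1) (λ r → bracket₂ r + tri∏ 2 r + tri∏ 1 r) q
      ≡⟨ weighted-*ˡ (tri 1) 2 _ q ⟨
    weighted (tri 1) (λ r → 2 * (bracket₂ r + tri∏ 2 r + tri∏ 1 r)) q
      ≡⟨ weighted-cong (tri 1) bracket₂-closedForm q ⟩
    weighted (tri 1) (λ r → tri∏ 1 (suc r)) q
      ≡⟨ weighted-tri∏-suc q ⟩
    q * tri∏ 1 (suc q)
      ∎
    where open ≡-Reasoning

  weighted-bracket₃ : ∀ q →
    weighted (tri 1) bracket₃ q + weighted (tri 1) (tri∏ 3) q + weighted (tri 1) (tri∏ 1) q ≡ q * tri∏ 1 (suc q)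
  weighted-bracket₃ q = begin
    weighted (tri 1) bracket₃ q + weighted (tri 1) (tri∏ 3) q + weighted (tri 1) (tri∏ 1) q
      ≡⟨ weighted-+₃ (tri 1) bracket₃ (tri∏ 3) (tri∏ 1) q ⟨
    weighted (tri 1) (λ r → bracket₃ r + tri∏ 3 r + tri∏ 1 r) q
      ≡⟨ weighted-cong (tri 1) bracket₃-closedForm q ⟩
    weighted (tri 1) (λ r → tri∏ 1 (suc r)) q
      ≡⟨ weighted-tri∏-suc q ⟩
    q * tri∏ 1 (suc q)
      ∎
    where open ≡-Reasoning


module Roots where

  open TripleFactorials using (tri)
  open import Data.Nat using (ℕ; zero; suc; _+_; _*_; _≤_; _<_; s≤s; z≤n)
  open import Data.Nat.Properties
  open import Data.Nat.Divisibility using (_∣_; divides; ∣-reflexive)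
  open import Data.Nat.DivMod using (_%_; _/_; m≡m%n+[m/n]*n; m%n<n)
  open import Data.Nat.Primality using (Prime; prime⇒irreducible)
  open import Data.Sum using (inj₁; inj₂)
  open import Relation.Nullary using (contradiction)
  open import Relation.Binary.PropositionalEquality
  open import Data.Nat.Tactic.RingSolver using (solve-∀)

  record LinearRoots (p : ℕ) : Set where
    field
      k₁ : ℕ
      p∣tri-k₁ : p ∣ tri 1 k₁
      2≤k₁ : 2 ≤ k₁
      k₁<p : k₁ < p
      k₂ : ℕ
      p∣tri-k₂ : p ∣ tri 2 k₂
      1≤k₂ : 1 ≤ k₂
      k₂<p : k₂ < p

  -- For p = 3q + 1 the roots are q and 2q, for p = 3q + 2 they are 2q + 1 and q.
  linearRoots : ∀ {p} → Prime p → 3 < p → LinearRoots p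
  linearRoots {p} p-prime 3<p with p % 3 | m%n<n p 3 | m≡m%n+[m/n]*n p 3
  ... | 0 | _ | p≡ = contradiction (prime⇒irreducible p-prime (divides (p / 3) p≡)) λ
    { (inj₁ ()) ; (inj₂ refl) → <-irrefl refl 3<p }
  ... | 1 | _ | p≡ = case₁ (p / 3) p≡
    where
    case₁ : ∀ q → p ≡ 1 + q * 3 → LinearRoots p
    case₁ zero refl = contradiction 3<p λ { (s≤s ()) }
    case₁ (suc zero) refl = contradiction (prime⇒irreducible p-prime {2} (divides 2 refl)) λ { (inj₁ ()) ; (inj₂ ()) }
    case₁ q@(suc (suc _)) refl = record
      { k₁ = q ; p∣tri-k₁ = ∣-reflexive (form₁ q) ; 2≤k₁ = s≤s (s≤s z≤n) ; k₁<p = s≤s (m≤m*n q 3)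
      ; k₂ = 2 * q ; p∣tri-k₂ = divides 2 (form₂ q) ; 1≤k₂ = s≤s z≤n
      ; k₂<p = s≤s (subst (2 * q ≤_) (*-comm 3 q) (*-monoˡ-≤ q {2} {3} (s≤s (s≤s z≤n)))) }
      where
      form₁ : ∀ q → 1 + q * 3 ≡ 3 * q + 1
      form₁ = solve-∀
      form₂ : ∀ q → 3 * (2 * q) + 2 ≡ 2 * (1 + q * 3)
      form₂ = solve-∀
  ... | 2 | _ | p≡ = case₂ (p / 3) p≡
    where
    case₂ : ∀ q → p ≡ 2 + q * 3 → LinearRoots p
    case₂ zero refl = contradiction 3<p λ { (s≤s (s≤s ())) }
    case₂ q@(suc q′) refl = record
      { k₁ = 2 * q + 1 ; p∣tri-k₁ = divides 2 (form₁ q) ; 2≤k₁ = subst (2 ≤_) (sym (+-comm (2 * q) 1)) (s≤s (s≤s z≤n))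
      ; k₁<p = subst₂ _<_ (+-comm 1 (2 * q)) (sym (form₃ q)) (s≤s (+-monoʳ-≤ 1 (*-monoˡ-≤ q {2} {3} (s≤s (s≤s z≤n)))))
      ; k₂ = q ; p∣tri-k₂ = ∣-reflexive (form₂ q) ; 1≤k₂ = s≤s z≤n
      ; k₂<p = s≤s (≤-trans (m≤m*n q 3) (m≤n+m (q * 3) 1)) }
      where
      form₁ : ∀ q → 3 * (2 * q + 1) + 1 ≡ 2 * (2 + q * 3)
      form₁ = solve-∀
      form₂ : ∀ q → 2 + q * 3 ≡ 3 * q + 2
      form₂ = solve-∀
      form₃ : ∀ q → 2 + q * 3 ≡ 1 + (1 + 3 * q)
      form₃ = solve-∀
  ... | suc (suc (suc _)) | s≤s (s≤s (s≤s ())) | _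


module RationalForm where

  open Ranges
  open TripleFactorials
  open WeightedSums
  open import Data.Nat using (ℕ; zero; suc; _+_; _*_; _∸_; _≤_; _<_; s≤s; z≤n)
  open import Data.Nat.Properties
  open import Data.Integer using (+_)
  import Data.Integer as ℤ
  import Data.Integer.Properties as ℤ
  open import Data.Rational as ℚ using (ℚ)
  import Data.Rational.Properties as ℚ
  open import Data.Rational.Unnormalised as ℚᵘ using (mkℚᵘ; *≡*)
  import Data.Rational.Unnormalised.Properties as ℚᵘ
  open import Relation.Binary.PropositionalEquality
  open import Data.Nat.Tactic.RingSolver using (solve-∀)
  open import Function using (flip)
  open import Data.Nat.Coprimality using (1-coprimeTo) renaming (sym to coprime-sym)
  open import Algebra.Properties.CommutativeSemigroup *-commutativeSemigroup using (x∙yz≈y∙xz)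

  ι : ℕ → ℚ
  ι n = frac n 1

  private
    toℚᵘ-ι : ∀ n → ℚ.toℚᵘ (ι n) ℚᵘ.≃ mkℚᵘ (+ n) 0
    toℚᵘ-ι n = ℚ.toℚᵘ-fromℚᵘ (mkℚᵘ (+ n) 0)

  ι-+ : ∀ a b → ι a ℚ.+ ι b ≡ ι (a + b)
  ι-+ a b = ℚ.toℚᵘ-injective (ℚᵘ.≃-trans (ℚ.toℚᵘ-homo-+ (ι a) (ι b))
    (ℚᵘ.≃-trans (ℚᵘ.+-cong (toℚᵘ-ι a) (toℚᵘ-ι b)) (ℚᵘ.≃-trans (*≡* eq) (ℚᵘ.≃-sym (toℚᵘ-ι (a + b))))))
    where
    eq : (+ a ℤ.* + 1 ℤ.+ + b ℤ.* + 1) ℤ.* + 1 ≡ + (a + b) ℤ.* + 1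
    eq = cong (ℤ._* + 1) (trans (cong₂ ℤ._+_ (ℤ.*-identityʳ (+ a)) (ℤ.*-identityʳ (+ b))) (sym (ℤ.pos-+ a b)))

  ι-* : ∀ a b → ι a ℚ.* ι b ≡ ι (a * b)
  ι-* a b = ℚ.toℚᵘ-injective (ℚᵘ.≃-trans (ℚ.toℚᵘ-homo-* (ι a) (ι b))
    (ℚᵘ.≃-trans (ℚᵘ.*-cong (toℚᵘ-ι a) (toℚᵘ-ι b)) (ℚᵘ.≃-trans (*≡* eq) (ℚᵘ.≃-sym (toℚᵘ-ι (a * b))))))
    where
    eq : (+ a ℤ.* + b) ℤ.* + 1 ≡ + (a * b) ℤ.* + 1
    eq = cong (ℤ._* + 1) (sym (ℤ.pos-* a b))

  frac-cancel : ∀ d c → 0 < d → frac (d * c) d ≡ ι c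
  frac-cancel (suc d) c _ = ℚ.fromℚᵘ-cong {mkℚᵘ (+ (suc d * c)) d} {mkℚᵘ (+ c) 0} (*≡* eq)
    where
    eq : + (suc d * c) ℤ.* + 1 ≡ + c ℤ.* + suc d
    eq = trans (ℤ.*-identityʳ _) (trans (ℤ.pos-* (suc d) c) (ℤ.*-comm (+ suc d) (+ c)))

  sumFromTo-ι : ∀ hi {f : ℕ → ℚ} {g : ℕ → ℕ} → (∀ k → 1 ≤ k → k ≤ hi → f k ≡ ι (g k)) →
    sumFromTo 1 hi f ≡ ι (∑ g 1 hi)
  sumFromTo-ι zero _ = refl
  sumFromTo-ι (suc hi) {f} {g} f≡ιg = begin
    f (suc hi) ℚ.+ sumFromTo 1 hi f
      ≡⟨ cong₂ ℚ._+_ (f≡ιg (suc hi) (s≤s z≤n) ≤-refl) (sumFromTo-ι hi λ k 1≤k k≤hi → f≡ιg k 1≤k (m≤n⇒m≤1+n k≤hi)) ⟩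
    ι (g (suc hi)) ℚ.+ ι (∑ g 1 hi)
      ≡⟨ ι-+ (g (suc hi)) (∑ g 1 hi) ⟩
    ι (g (suc hi) + ∑ g 1 hi)
      ≡⟨ cong ι (+-comm (g (suc hi)) (∑ g 1 hi)) ⟩
    ι (∑ g 1 (suc hi))
      ∎
    where open ≡-Reasoning

  frac-!!!-split : ∀ a s {n r} → n ≤ r → frac (a * (3 * r + s) !!!) ((3 * n + s) !!!) ≡ ι (a * ∏ (tri s) (suc n) (r ∸ n))
  frac-!!!-split a s {n} {r} n≤r = begin
    frac (a * (3 * r + s) !!!) d            ≡⟨ cong (λ x → frac (a * x) d) (!!!-split s n≤r) ⟩
    frac (a * (d * R)) d                    ≡⟨ cong (λ x → frac x d) (x∙yz≈y∙xz a d R) ⟩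
    frac (d * (a * R)) d                    ≡⟨ frac-cancel d (a * R) (!!!-pos (3 * n + s)) ⟩
    ι (a * R)                               ∎
    where
    open ≡-Reasoning
    d = (3 * n + s) !!!
    R = ∏ (tri s) (suc n) (r ∸ n)

  ι≡mkℚ : ∀ g → ι g ≡ ℚ.mkℚ (+ g) 0 (coprime-sym (1-coprimeTo g))
  ι≡mkℚ g = ℚ.normalize-coprime (coprime-sym (1-coprimeTo g))

  γ≡ιΓ : ∀ p → γ p ≡ ι (Γ p)
  γ≡ιΓ zero = refl
  γ≡ιΓ p@(suc q) = sumFromTo-ι q summand
    where
    summand : ∀ r → 1 ≤ r → r ≤ q →
      frac ((3 * p + 1) !!!) ((3 * r + 4) !!!) ℚ.*
        (frac ((3 * r + 2) !!!) 1 ℚ.+ frac ((3 * r + 3) !!!) 1 ℚ.+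
         sumFromTo 1 (r ∸ 1) λ n →
           frac ((3 * n + 1) !!! * (3 * r + 2) !!!) ((3 * n + 2) !!!) ℚ.+
           frac ((3 * n + 1) !!! * (3 * r + 3) !!!) ((3 * n + 3) !!!))
      ≡ ι (∏ (tri 1) (2 + r) (p ∸ suc r) * innerSum r)
    summand r _ r≤q = trans (cong₂ ℚ._*_ outer bracket) (ι-* (∏ (tri 1) (2 + r) (p ∸ suc r)) (innerSum r))
      where
      ratio : ∀ s n → n ≤ r → frac ((3 * n + 1) !!! * (3 * r + s) !!!) ((3 * n + s) !!!) ≡ ι (tri∏ 1 n * ∏ (tri s) (suc n) (r ∸ n))
      ratio s n n≤r = trans (frac-!!!-split ((3 * n + 1) !!!) s n≤r)
                            (cong (λ a → ι (a * ∏ (tri s) (suc n) (r ∸ n))) (trans (!!!-tri∏ 1 n) (*-identityˡ _)))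
      outer : frac ((3 * p + 1) !!!) ((3 * r + 4) !!!) ≡ ι (∏ (tri 1) (2 + r) (p ∸ suc r))
      outer = begin
        frac ((3 * p + 1) !!!) ((3 * r + 4) !!!)               ≡⟨ cong₂ (λ x y → frac x (y !!!)) (sym (*-identityˡ _)) (shift r) ⟩
        frac (1 * (3 * p + 1) !!!) ((3 * suc r + 1) !!!)       ≡⟨ frac-!!!-split 1 1 (s≤s r≤q) ⟩
        ι (1 * ∏ (tri 1) (2 + r) (p ∸ suc r))                  ≡⟨ cong ι (*-identityˡ (∏ (tri 1) (2 + r) (p ∸ suc r))) ⟩
        ι (∏ (tri 1) (2 + r) (p ∸ suc r))                      ∎
        where
        open ≡-Reasoning
        shift : ∀ r → 3 * r + 4 ≡ 3 * suc r + 1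
        shift = solve-∀
      bracket : frac ((3 * r + 2) !!!) 1 ℚ.+ frac ((3 * r + 3) !!!) 1 ℚ.+
                (sumFromTo 1 (r ∸ 1) λ n →
                   frac ((3 * n + 1) !!! * (3 * r + 2) !!!) ((3 * n + 2) !!!) ℚ.+
                   frac ((3 * n + 1) !!! * (3 * r + 3) !!!) ((3 * n + 3) !!!))
                ≡ ι (innerSum r)
      bracket = flip trans (ι-+ (tri∏ 2 r + 3 * tri∏ 3 r) (∑ inner 1 (r ∸ 1))) (cong₂ ℚ._+_
        (trans (cong₂ (λ x y → ι x ℚ.+ ι y) (trans (!!!-tri∏ 2 r) (*-identityˡ _)) (!!!-tri∏ 3 r)) (ι-+ (tri∏ 2 r) (3 * tri∏ 3 r)))
        (sumFromTo-ι (r ∸ 1) λ n _ n≤r-1 → let n≤r = ≤-trans n≤r-1 (m∸n≤m r 1) in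
           trans (cong₂ ℚ._+_ (ratio 2 n n≤r) (ratio 3 n n≤r)) (ι-+ (part 2 n) (part 3 n))))
        where
        part : ℕ → ℕ → ℕ
        part s n = tri∏ 1 n * ∏ (tri s) (suc n) (r ∸ n)
        inner : ℕ → ℕ
        inner n = part 2 n + part 3 n


module Modular where

  open Ranges using (∑; ∣-∑; ∏; ∏-cons; ∣-∏)
  open Binomials
  open TripleFactorials
  open WeightedSums
  open Roots
  open import Data.Nat as ℕ using (ℕ; zero; suc; _≤_; _<_; s≤s; z≤n; _!; _∸_)
  import Data.Nat.Properties as ℕ
  import Data.Nat.Divisibility as ℕ
  open import Data.Nat.DivMod using (_%_; _/_; m≡m%n+[m/n]*n; m%n<n)
  open import Data.Nat.Primality using (Prime; euclidsLemma)
  open import Data.Nat.ListAction using (product)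
  open import Data.Integer using (ℤ; +_; _+_; _*_; _-_; -_; _^_; 0ℤ; 1ℤ; -1ℤ; ∣_∣)
  import Data.Nat.Tactic.RingSolver as ℕ-Solver
  import Data.Integer.Properties as ℤ
  open import Data.Integer.Divisibility.Signed using (_∣_; ∣-refl; ∣n⇒∣m*n; ∣m⇒∣m*n; ∣m∣n⇒∣m+n; ∣m⇒∣-m; ∣ᵤ⇒∣; ∣⇒∣ᵤ)
  open import Data.Integer.Tactic.RingSolver using (solve-∀)
  open import Data.List using (List; []; _∷_; length; applyDownFrom)
  open import Data.List.Membership.Propositional using (_∈_)
  open import Data.List.Membership.Propositional.Properties using (∈-∃++; ∈-applyDownFrom⁺; ∈-applyDownFrom⁻)
  open import Data.List.Relation.Unary.Any using (here; there)
  open import Data.List.Relation.Unary.Unique.Propositional using (Unique)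
  open import Data.List.Relation.Unary.Unique.Propositional.Properties using (applyDownFrom⁺₁)
  open import Data.List.Relation.Unary.Unique.Setoid.Properties using (Unique[x∷xs]⇒x∉xs)
  open import Data.List.Relation.Unary.AllPairs using (_∷_; tail)
  open import Data.List.Relation.Binary.Permutation.Propositional using (_↭_; ↭-sym; ↭⇒↭ₛ)
  open import Data.List.Relation.Binary.Permutation.Propositional.Properties using (shift; ∈-resp-↭; ↭-length)
  open import Data.List.Relation.Binary.Permutation.Setoid.Properties using (Unique-resp-↭)
  open import Data.Nat.ListAction.Properties using (product-↭)
  open import Data.Product using (∃; _×_; _,_; proj₁; proj₂)
  open import Function using (_∘′_)
  open import Data.Sum using (_⊎_; inj₁; inj₂)
  import Data.Sum as Sum
  open import Relation.Nullary using (¬_; yes; no; contradiction)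
  open import Relation.Binary.Bundles using (Setoid)
  open import Relation.Binary.PropositionalEquality
  import Relation.Binary.Reasoning.Setoid as SetoidReasoning

  module Congruence (m : ℕ) where

    infix 4 _≈_
    record _≈_ (x y : ℤ) : Set where
      constructor mod
      field m∣x-y : + m ∣ x - y

    ≈-reflexive : ∀ {x y} → x ≡ y → x ≈ y
    ≈-reflexive {x} refl = mod (∣-reflexive′ (sym (ℤ.+-inverseʳ x)))
      where
      ∣-reflexive′ : ∀ {z} → 0ℤ ≡ z → + m ∣ z
      ∣-reflexive′ refl = ∣n⇒∣m*n 0ℤ ∣-refl

    ≈-refl : ∀ {x} → x ≈ x
    ≈-refl = ≈-reflexive refl

    ≈-sym : ∀ {x y} → x ≈ y → y ≈ x
    ≈-sym {x} {y} (mod m∣x-y) = mod (subst (+ m ∣_) (negate x y) (∣m⇒∣-m m∣x-y))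
      where
      negate : ∀ x y → - (x - y) ≡ y - x
      negate = solve-∀

    ≈-trans : ∀ {x y z} → x ≈ y → y ≈ z → x ≈ z
    ≈-trans {x} {y} {z} (mod m∣x-y) (mod m∣y-z) = mod (subst (+ m ∣_) (telescope x y z) (∣m∣n⇒∣m+n m∣x-y m∣y-z))
      where
      telescope : ∀ x y z → (x - y) + (y - z) ≡ x - z
      telescope = solve-∀

    ≈-setoid : Setoid _ _
    ≈-setoid = record
      { Carrier = ℤ ; _≈_ = _≈_
      ; isEquivalence = record { refl = ≈-refl ; sym = ≈-sym ; trans = ≈-trans } }

    module ≈-Reasoning = SetoidReasoning ≈-setoid

    +-cong : ∀ {a b c d} → a ≈ b → c ≈ d → a + c ≈ b + d
    +-cong {a} {b} {c} {d} (mod m∣a-b) (mod m∣c-d) = mod (subst (+ m ∣_) (regroup a b c d) (∣m∣n⇒∣m+n m∣a-b m∣c-d))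
      where
      regroup : ∀ a b c d → (a - b) + (c - d) ≡ (a + c) - (b + d)
      regroup = solve-∀

    -‿cong : ∀ {a b} → a ≈ b → - a ≈ - b
    -‿cong {a} {b} (mod m∣a-b) = mod (subst (+ m ∣_) (negate a b) (∣m⇒∣-m m∣a-b))
      where
      negate : ∀ a b → - (a - b) ≡ - a - - b
      negate = solve-∀

    *-cong : ∀ {a b c d} → a ≈ b → c ≈ d → a * c ≈ b * d
    *-cong {a} {b} {c} {d} (mod m∣a-b) (mod m∣c-d) =
      mod (subst (+ m ∣_) (regroup a b c d) (∣m∣n⇒∣m+n (∣m⇒∣m*n c m∣a-b) (∣n⇒∣m*n b m∣c-d)))
      where
      regroup : ∀ a b c d → (a - b) * c + b * (c - d) ≡ a * c - b * d
      regroup = solve-∀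

    ∣⇒≈0 : ∀ {x} → + m ∣ x → x ≈ 0ℤ
    ∣⇒≈0 {x} m∣x = mod (subst (+ m ∣_) (sym (ℤ.+-identityʳ x)) m∣x)

    ∣ℕ⇒≈0 : ∀ {n} → m ℕ.∣ n → + n ≈ 0ℤ
    ∣ℕ⇒≈0 m∣n = ∣⇒≈0 (∣ᵤ⇒∣ m∣n)

    ≈-dropMultiple : ∀ {a b c} → a ≡ b ℕ.+ c → m ℕ.∣ c → + a ≈ + b
    ≈-dropMultiple {a} {b} {c} refl m∣c = begin
      + (b ℕ.+ c)  ≡⟨ ℤ.pos-+ b c ⟩
      + b + + c    ≈⟨ +-cong (≈-refl {+ b}) (∣ℕ⇒≈0 m∣c) ⟩
      + b + 0ℤ     ≡⟨ ℤ.+-identityʳ (+ b) ⟩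
      + b          ∎
      where open ≈-Reasoning

    ≈-negate : ∀ {a b} → m ℕ.∣ a ℕ.+ b → + a ≈ - + b
    ≈-negate {a} {b} m∣a+b = begin
      + a                ≡⟨ shuffle (+ a) (+ b) ⟩
      (+ a + + b) - + b  ≡⟨ cong (_- + b) (ℤ.pos-+ a b) ⟨
      + (a ℕ.+ b) - + b  ≈⟨ +-cong (∣ℕ⇒≈0 m∣a+b) (≈-refl { - + b}) ⟩
      0ℤ - + b           ≡⟨ ℤ.+-identityˡ (- + b) ⟩
      - + b              ∎
      where
      open ≈-Reasoning
      shuffle : ∀ x y → x ≡ (x + y) - y
      shuffle = solve-∀


    module Pairing (inv : ℕ → ℕ) where

      record Paired (xs : List ℕ) : Set where
        field
          unique     : Unique xs
          closed     : ∀ {x} → x ∈ xs → inv x ∈ xs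
          involutive : ∀ {x} → x ∈ xs → inv (inv x) ≡ x
          inverse    : ∀ {x} → x ∈ xs → + x * + inv x ≈ 1ℤ
          fixed      : ∀ {x} → x ∈ xs → inv x ≡ x → + x ≈ 1ℤ

      restrict : ∀ {xs ys} → (∀ {y} → y ∈ ys → y ∈ xs) → Unique ys →
                 (∀ {y} → y ∈ ys → inv y ∈ ys) → Paired xs → Paired ys
      restrict ys⊆xs unique-ys closed-ys P = record
        { unique = unique-ys ; closed = closed-ys
        ; involutive = involutive ∘′ ys⊆xs ; inverse = inverse ∘′ ys⊆xs ; fixed = fixed ∘′ ys⊆xs }
        where open Paired P

      private
        ∈⇒↭ : ∀ {v : ℕ} {xs} → v ∈ xs → ∃ λ rest → xs ↭ v ∷ rest
        ∈⇒↭ {v} v∈xs with ∈-∃++ v∈xs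
        ... | ys , zs , refl = _ , shift v ys zs

        Paired-tail : ∀ {x xs} → Paired (x ∷ xs) → inv x ≡ x → Paired xs
        Paired-tail {x} {xs} P fix = restrict there (tail unique) (λ y∈xs → closed-tail y∈xs (closed (there y∈xs))) P
          where
          open Paired P
          closed-tail : ∀ {y} → y ∈ xs → inv y ∈ x ∷ xs → inv y ∈ xs
          closed-tail y∈xs (here iy≡x) = contradiction
            (subst (_∈ xs) (trans (sym (involutive (there y∈xs))) (trans (cong inv iy≡x) fix)) y∈xs)
            (Unique[x∷xs]⇒x∉xs (setoid ℕ) unique)
          closed-tail _ (there iy∈xs) = iy∈xs

        Paired-remove : ∀ {x xs rest} → Paired (x ∷ xs) → xs ↭ inv x ∷ rest → Paired rest
        Paired-remove {x} {xs} {rest} P σ =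
          restrict (there ∘′ rest⊆xs) (tail unique-σ) (λ y∈rest → closed-rest y∈rest (closed (there (rest⊆xs y∈rest)))) P
          where
          open Paired P
          unique-σ : Unique (inv x ∷ rest)
          unique-σ = Unique-resp-↭ (setoid ℕ) (↭⇒↭ₛ σ) (tail unique)
          rest⊆xs : ∀ {y} → y ∈ rest → y ∈ xs
          rest⊆xs y∈rest = ∈-resp-↭ (↭-sym σ) (there y∈rest)
          closed-rest : ∀ {y} → y ∈ rest → inv y ∈ x ∷ xs → inv y ∈ rest
          closed-rest y∈rest (here iy≡x) = contradiction
            (subst (_∈ rest) (trans (sym (involutive (there (rest⊆xs y∈rest)))) (cong inv iy≡x)) y∈rest)
            (Unique[x∷xs]⇒x∉xs (setoid ℕ) unique-σ)
          closed-rest y∈rest (there iy∈xs) with ∈-resp-↭ σ iy∈xs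
          ... | here iy≡ix = contradiction
            (subst (_∈ xs) (trans (sym (involutive (there (rest⊆xs y∈rest)))) (trans (cong inv iy≡ix) (involutive (here refl))))
                   (rest⊆xs y∈rest))
            (Unique[x∷xs]⇒x∉xs (setoid ℕ) unique)
          ... | there iy∈rest = iy∈rest

        product-bounded : ∀ k xs → length xs ≤ k → Paired xs → + product xs ≈ 1ℤ
        product-bounded k [] _ _ = ≈-refl
        product-bounded (suc k) (x ∷ xs) (s≤s len) P with inv x ℕ.≟ x | Paired.closed P (here refl)
        ... | yes fix | _ = begin
          + (x ℕ.* product xs)     ≡⟨ ℤ.pos-* x (product xs) ⟩
          + x * + product xs       ≈⟨ *-cong (Paired.fixed P (here refl) fix) (product-bounded k xs len (Paired-tail P fix)) ⟩
          1ℤ * 1ℤ                  ≡⟨⟩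
          1ℤ                       ∎
          where open ≈-Reasoning
        ... | no ¬fix | here ix≡x = contradiction ix≡x ¬fix
        ... | no _ | there ix∈xs with ∈⇒↭ ix∈xs
        ...   | rest , σ = begin
          + (x ℕ.* product xs)                   ≡⟨ cong (λ m → + (x ℕ.* m)) (product-↭ σ) ⟩
          + (x ℕ.* (inv x ℕ.* product rest))     ≡⟨ cong +_ (sym (ℕ.*-assoc x (inv x) _)) ⟩
          + (x ℕ.* inv x ℕ.* product rest)       ≡⟨ trans (ℤ.pos-* (x ℕ.* inv x) _) (cong (_* + product rest) (ℤ.pos-* x (inv x))) ⟩
          + x * + inv x * + product rest         ≈⟨ *-cong (Paired.inverse P (here refl)) (product-bounded k rest len′ (Paired-remove P σ)) ⟩
          1ℤ * 1ℤ                                ≡⟨⟩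
          1ℤ                                     ∎
          where
          open ≈-Reasoning
          len′ : length rest ≤ k
          len′ = ℕ.≤-pred (ℕ.≤-trans (ℕ.≤-reflexive (↭-length (↭-sym σ))) (ℕ.m≤n⇒m≤1+n len))

      product≈1 : ∀ xs → Paired xs → + product xs ≈ 1ℤ
      product≈1 xs = product-bounded (length xs) xs ℕ.≤-refl

  module PrimeModulus {n : ℕ} (p-prime : Prime (2 ℕ.+ n)) where

    p : ℕ
    p = 2 ℕ.+ n

    open Congruence p public

    ∣-euclid : ∀ x y → + p ∣ x * y → (+ p ∣ x) ⊎ (+ p ∣ y)
    ∣-euclid x y p∣xy with euclidsLemma ∣ x ∣ ∣ y ∣ p-prime (subst (p ℕ.∣_) (ℤ.abs-* x y) (∣⇒∣ᵤ p∣xy))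
    ... | inj₁ p∣x = inj₁ (∣ᵤ⇒∣ p∣x)
    ... | inj₂ p∣y = inj₂ (∣ᵤ⇒∣ p∣y)

    ≈-cancelˡ : ∀ c {x y} → ¬ (+ p ∣ c) → c * x ≈ c * y → x ≈ y
    ≈-cancelˡ c {x} {y} p∤c (mod p∣cx-cy) with ∣-euclid c (x - y) (subst (+ p ∣_) (factor c x y) p∣cx-cy)
      where
      factor : ∀ c x y → c * x - c * y ≡ c * (x - y)
      factor = solve-∀
    ... | inj₁ p∣c = contradiction p∣c p∤c
    ... | inj₂ p∣x-y = mod p∣x-y

    ∤-unit : ∀ {a} → 0 < a → a < p → ¬ (+ p ∣ + a)
    ∤-unit {suc a} _ a<p p∣a = ℕ.>⇒∤ a<p (∣⇒∣ᵤ p∣a)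

    private
      ≈⇒≡-≥ : ∀ {b c} → c ≤ b → b < p → + b ≈ + c → b ≡ c
      ≈⇒≡-≥ {b} {c} c≤b b<p (mod p∣b-c) with b ∸ c in eq
      ... | zero = ℕ.≤-antisym (ℕ.m∸n≡0⇒m≤n eq) c≤b
      ... | suc d = contradiction (∣⇒∣ᵤ (subst (+ p ∣_) (trans (ℤ.[+m]-[+n]≡m⊖n b c) (trans (ℤ.⊖-≥ c≤b) (cong +_ eq))) p∣b-c))
                                  (ℕ.>⇒∤ (subst (_< p) eq (ℕ.≤-<-trans (ℕ.m∸n≤m b c) b<p)))

    ≈⇒≡ : ∀ {b c} → b < p → c < p → + b ≈ + c → b ≡ c
    ≈⇒≡ {b} {c} b<p c<p b≈c with ℕ.≤-total c b
    ... | inj₁ c≤b = ≈⇒≡-≥ c≤b b<p b≈c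
    ... | inj₂ b≤c = sym (≈⇒≡-≥ b≤c c<p (≈-sym b≈c))

    fermat : ∀ a → + (a ℕ.^ p) ≈ + a
    fermat zero = ≈-refl
    fermat (suc a) = begin
      + ((1 ℕ.+ a) ℕ.^ p)     ≈⟨ ≈-dropMultiple (binomial-theorem-ends a (suc n)) p∣middle ⟩
      + (1 ℕ.+ a ℕ.^ p)       ≈⟨ +-cong (≈-refl {+ 1}) (fermat a) ⟩
      + (1 ℕ.+ a)           ∎
      where
      open ≈-Reasoning
      p∣middle : p ℕ.∣ ∑ (binomialTerm a p) 1 (suc n)
      p∣middle = ∣-∑ 1 (suc n) λ k 1≤k k<p → ℕ.∣m⇒∣m*n (a ℕ.^ k) (prime∣binomial p-prime 1≤k k<p)

    fermat-unit : ∀ {a} → 0 < a → a < p → + (a ℕ.^ suc n) ≈ 1ℤ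
    fermat-unit {a} 0<a a<p = ≈-cancelˡ (+ a) (∤-unit 0<a a<p) (begin
      + a * + (a ℕ.^ suc n)   ≡⟨ ℤ.pos-* a (a ℕ.^ suc n) ⟨
      + (a ℕ.^ p)             ≈⟨ fermat a ⟩
      + a                   ≡⟨ ℤ.*-identityʳ (+ a) ⟨
      + a * 1ℤ              ∎)
      where open ≈-Reasoning

    %-≈ : ∀ x → + (x % p) ≈ + x
    %-≈ x = ≈-sym (≈-dropMultiple (m≡m%n+[m/n]*n x p) (ℕ.n∣m*n (x / p)))

    -1≈p-1 : - 1ℤ ≈ + suc n
    -1≈p-1 = ≈-sym (≈-negate (ℕ.∣-reflexive (cong suc (ℕ.+-comm 1 n))))

    opaque
      inverse : ℕ → ℕ
      inverse a = a ℕ.^ n % p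

      inverse-< : ∀ a → inverse a < p
      inverse-< a = m%n<n (a ℕ.^ n) p

      *-inverse : ∀ {a} → 0 < a → a < p → + a * + inverse a ≈ 1ℤ
      *-inverse {a} 0<a a<p = begin
        + a * + inverse a      ≈⟨ *-cong (≈-refl {+ a}) (%-≈ (a ℕ.^ n)) ⟩
        + a * + (a ℕ.^ n)        ≡⟨ ℤ.pos-* a (a ℕ.^ n) ⟨
        + (a ℕ.^ suc n)          ≈⟨ fermat-unit 0<a a<p ⟩
        1ℤ                     ∎
        where open ≈-Reasoning

    inverse-unique : ∀ {a b} → 0 < a → a < p → b < p → + a * + b ≈ 1ℤ → b ≡ inverse a
    inverse-unique {a} 0<a a<p b<p ab≈1 =
      ≈⇒≡ b<p (inverse-< a) (≈-cancelˡ (+ a) (∤-unit 0<a a<p) (≈-trans ab≈1 (≈-sym (*-inverse 0<a a<p))))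

    inverse-pos : ∀ {a} → 0 < a → a < p → 0 < inverse a
    inverse-pos {a} 0<a a<p with inverse a in eq
    ... | suc _ = s≤s z≤n
    ... | zero = contradiction (≈⇒≡ (s≤s z≤n) (s≤s (s≤s z≤n)) 0≈1) λ ()
      where
      0≈1 : + 0 ≈ 1ℤ
      0≈1 = ≈-trans (≈-reflexive (sym (ℤ.*-zeroʳ (+ a)))) (subst (λ b → + a * + b ≈ 1ℤ) eq (*-inverse 0<a a<p))

    inverse-involutive : ∀ {a} → 0 < a → a < p → inverse (inverse a) ≡ a
    inverse-involutive {a} 0<a a<p = sym (inverse-unique (inverse-pos 0<a a<p) (inverse-< a) a<p
      (≈-trans (≈-reflexive (ℤ.*-comm (+ inverse a) (+ a))) (*-inverse 0<a a<p)))

    inverse-p-1 : inverse (suc n) ≡ suc n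
    inverse-p-1 = sym (inverse-unique (s≤s z≤n) ℕ.≤-refl ℕ.≤-refl (begin
      + suc n * + suc n      ≈⟨ *-cong (≈-sym -1≈p-1) (≈-sym -1≈p-1) ⟩
      - 1ℤ * - 1ℤ            ≡⟨⟩
      1ℤ                     ∎))
      where open ≈-Reasoning

    square≈1 : ∀ x → x * x ≈ 1ℤ → x ≈ 1ℤ ⊎ x ≈ - 1ℤ
    square≈1 x x²≈1 = Sum.map mod (λ p∣x+1 → mod (subst (+ p ∣_) (shuffle x) p∣x+1))
      (∣-euclid (x - 1ℤ) (x + 1ℤ) (subst (+ p ∣_) (factor x) (_≈_.m∣x-y x²≈1)))
      where
      factor : ∀ x → x * x - 1ℤ ≡ (x - 1ℤ) * (x + 1ℤ)
      factor = solve-∀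
      shuffle : ∀ x → x + 1ℤ ≡ x - - 1ℤ
      shuffle = solve-∀

    inverse-fixed : ∀ {a} → 0 < a → a < p → inverse a ≡ a → a ≡ 1 ⊎ a ≡ suc n
    inverse-fixed {a} 0<a a<p fix = Sum.map (≈⇒≡ a<p (s≤s (s≤s z≤n))) (λ a≈-1 → ≈⇒≡ a<p ℕ.≤-refl (≈-trans a≈-1 -1≈p-1))
      (square≈1 (+ a) (subst (λ b → + a * + b ≈ 1ℤ) fix (*-inverse 0<a a<p)))

    product-applyDownFrom-suc : ∀ k → product (applyDownFrom suc k) ≡ k !
    product-applyDownFrom-suc zero = refl
    product-applyDownFrom-suc (suc k) = cong (suc k ℕ.*_) (product-applyDownFrom-suc k)

    private
      units : List ℕ
      units = applyDownFrom suc n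

      ∈-units⁻ : ∀ {x} → x ∈ units → 0 < x × x < suc n
      ∈-units⁻ x∈ with ∈-applyDownFrom⁻ suc x∈
      ... | i , i<n , refl = s≤s z≤n , s≤s i<n

      ∈-units⁺ : ∀ {y} → 0 < y → y < suc n → y ∈ units
      ∈-units⁺ {suc j} _ (s≤s j<n) = ∈-applyDownFrom⁺ suc j<n

      unit : ∀ {x} → x ∈ units → 0 < x × x < p
      unit x∈ with ∈-units⁻ x∈
      ... | 0<x , x<p-1 = 0<x , ℕ.m<n⇒m<1+n x<p-1

      inverse-units : ∀ {x} → x ∈ units → inverse x ∈ units
      inverse-units {x} x∈ with unit x∈
      ... | 0<x , x<p with ℕ.m≤n⇒m<n∨m≡n (ℕ.≤-pred (inverse-< x))
      ...   | inj₁ y<p-1 = ∈-units⁺ (inverse-pos 0<x x<p) y<p-1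
      ...   | inj₂ y≡p-1 = contradiction
        (trans (sym (inverse-involutive 0<x x<p)) (trans (cong inverse y≡p-1) inverse-p-1))
        (ℕ.<⇒≢ (proj₂ (∈-units⁻ x∈)))

      units-paired : Pairing.Paired inverse units
      units-paired = record
        { unique = applyDownFrom⁺₁ suc n λ j<i _ eq → ℕ.<⇒≢ j<i (sym (ℕ.suc-injective eq))
        ; closed = inverse-units
        ; involutive = λ x∈ → inverse-involutive (proj₁ (unit x∈)) (proj₂ (unit x∈))
        ; inverse = λ x∈ → *-inverse (proj₁ (unit x∈)) (proj₂ (unit x∈))
        ; fixed = fixed }
        where
        fixed : ∀ {x} → x ∈ units → inverse x ≡ x → + x ≈ 1ℤ
        fixed x∈ fix with inverse-fixed (proj₁ (unit x∈)) (proj₂ (unit x∈)) fix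
        ... | inj₁ refl = ≈-refl
        ... | inj₂ refl = contradiction (proj₂ (∈-units⁻ x∈)) (ℕ.<-irrefl refl)

    -- The residues 1, …, p - 2 pair off into inverses; p - 1 is its own inverse and contributes -1.
    wilson : + ((p ∸ 1) !) ≈ - 1ℤ
    wilson = begin
      + (suc n ℕ.* n !)                ≡⟨ cong (λ f → + (suc n ℕ.* f)) (product-applyDownFrom-suc n) ⟨
      + (suc n ℕ.* product units)      ≡⟨ ℤ.pos-* (suc n) _ ⟩
      + suc n * + product units        ≈⟨ *-cong (≈-sym -1≈p-1) (Pairing.product≈1 inverse units units-paired) ⟩
      - 1ℤ * 1ℤ                        ≡⟨⟩
      - 1ℤ                             ∎
      where open ≈-Reasoning

  module Progressions (m : ℕ) where

    open Congruence m

    ∏-tri-below : ∀ s a j → m ℕ.∣ tri s (a ℕ.+ j) → + ∏ (tri s) a j ≈ (- + 3) ^ j * + (j !)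
    ∏-tri-below s a zero _ = ≈-refl
    ∏-tri-below s a (suc j) m∣ = begin
      + ∏ (tri s) a (suc j)                        ≡⟨ cong +_ (∏-cons (tri s) a j) ⟩
      + (tri s a ℕ.* ∏ (tri s) (suc a) j)          ≡⟨ ℤ.pos-* (tri s a) _ ⟩
      + tri s a * + ∏ (tri s) (suc a) j            ≈⟨ *-cong (≈-negate m∣sum) (∏-tri-below s (suc a) j m∣′) ⟩
      - + (3 ℕ.* suc j) * (σ * + (j !))              ≡⟨ cong (λ x → - x * (σ * + (j !))) (ℤ.pos-* 3 (suc j)) ⟩
      - (+ 3 * + suc j) * (σ * + (j !))              ≡⟨ regroup σ (+ suc j) (+ (j !)) ⟩
      (- + 3 * σ) * (+ suc j * + (j !))              ≡⟨ cong ((- + 3 * σ) *_) (ℤ.pos-* (suc j) (j !)) ⟨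
      (- + 3 * σ) * + (suc j !)                      ∎
      where
      open ≈-Reasoning
      σ = (- + 3) ^ j
      m∣sum : m ℕ.∣ tri s a ℕ.+ 3 ℕ.* suc j
      m∣sum = subst (m ℕ.∣_) (split-index s a j) m∣
        where
        split-index : ∀ s a j → 3 ℕ.* (a ℕ.+ suc j) ℕ.+ s ≡ 3 ℕ.* a ℕ.+ s ℕ.+ 3 ℕ.* suc j
        split-index = ℕ-Solver.solve-∀
      m∣′ : m ℕ.∣ tri s (suc a ℕ.+ j)
      m∣′ = subst (λ k → m ℕ.∣ tri s k) (ℕ.+-suc a j) m∣
      regroup : ∀ σ u f → - (+ 3 * u) * (σ * f) ≡ (- + 3 * σ) * (u * f)
      regroup = solve-∀

    ∏-tri-above : ∀ s k t → m ℕ.∣ tri s k → + ∏ (tri s) (suc k) t ≈ + (3 ℕ.^ t) * + (t !)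
    ∏-tri-above s k zero _ = ≈-refl
    ∏-tri-above s k (suc t) m∣ = begin
      + (∏ (tri s) (suc k) t ℕ.* tri s (suc k ℕ.+ t))             ≡⟨ ℤ.pos-* (∏ (tri s) (suc k) t) (tri s (suc k ℕ.+ t)) ⟩
      + ∏ (tri s) (suc k) t * + tri s (suc k ℕ.+ t)               ≈⟨ *-cong (∏-tri-above s k t m∣) (≈-dropMultiple (split-index s k t) m∣) ⟩
      + (3 ℕ.^ t) * + (t !) * + (3 ℕ.* suc t)                       ≡⟨ cong (+ (3 ℕ.^ t) * + (t !) *_) (ℤ.pos-* 3 (suc t)) ⟩
      + (3 ℕ.^ t) * + (t !) * (+ 3 * + suc t)                       ≡⟨ regroup (+ (3 ℕ.^ t)) (+ (t !)) (+ suc t) ⟩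
      (+ 3 * + (3 ℕ.^ t)) * (+ suc t * + (t !))                     ≡⟨ cong₂ _*_ (ℤ.pos-* 3 (3 ℕ.^ t)) (ℤ.pos-* (suc t) (t !)) ⟨
      + (3 ℕ.^ suc t) * + (suc t !)                                 ∎
      where
      open ≈-Reasoning
      split-index : ∀ s k t → 3 ℕ.* (suc k ℕ.+ t) ℕ.+ s ≡ 3 ℕ.* suc t ℕ.+ (3 ℕ.* k ℕ.+ s)
      split-index = ℕ-Solver.solve-∀
      regroup : ∀ x f u → x * f * (+ 3 * u) ≡ (+ 3 * x) * (u * f)
      regroup = solve-∀

    -- Reflecting the factors -1, …, -j to t + 1, …, t + j uses j + t + 1 ≡ 0.
    reflect : ∀ j t → m ℕ.∣ suc (j ℕ.+ t) →
      (- + 3) ^ j * + (j !) * (+ (3 ℕ.^ t) * + (t !)) ≈ + (3 ℕ.^ (j ℕ.+ t)) * + ((j ℕ.+ t) !)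
    reflect zero t _ = ≈-reflexive (unit (+ (3 ℕ.^ t)) (+ (t !)))
      where
      unit : ∀ x f → 1ℤ * + 1 * (x * f) ≡ x * f
      unit = solve-∀
    reflect (suc j) t m∣ = begin
      (- + 3 * σ) * + (suc j !) * (x * + (t !))
        ≡⟨ cong (λ f → (- + 3 * σ) * f * (x * + (t !))) (ℤ.pos-* (suc j) (j !)) ⟩
      (- + 3 * σ) * (+ suc j * + (j !)) * (x * + (t !))
        ≡⟨ regroup σ (+ (j !)) x (+ (t !)) (+ suc j) ⟩
      σ * + (j !) * ((+ 3 * x) * (- + suc j * + (t !)))
        ≈⟨ *-cong (≈-refl {σ * + (j !)}) (*-cong (≈-refl {+ 3 * x}) (*-cong (≈-sym (≈-negate m∣′)) (≈-refl {+ (t !)}))) ⟩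
      σ * + (j !) * ((+ 3 * x) * (+ suc t * + (t !)))
        ≡⟨ cong₂ (λ y f → σ * + (j !) * (y * f)) (ℤ.pos-* 3 (3 ℕ.^ t)) (ℤ.pos-* (suc t) (t !)) ⟨
      σ * + (j !) * (+ (3 ℕ.^ suc t) * + (suc t !))
        ≈⟨ reflect j (suc t) (subst (m ℕ.∣_) (cong suc (sym (ℕ.+-suc j t))) m∣) ⟩
      + (3 ℕ.^ (j ℕ.+ suc t)) * + ((j ℕ.+ suc t) !)
        ≡⟨ cong (λ k → + (3 ℕ.^ k) * + (k !)) (ℕ.+-suc j t) ⟩
      + (3 ℕ.^ suc (j ℕ.+ t)) * + (suc (j ℕ.+ t) !)
        ∎
      where
      open ≈-Reasoning
      σ = (- + 3) ^ j
      x = + (3 ℕ.^ t)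
      m∣′ : m ℕ.∣ suc t ℕ.+ suc j
      m∣′ = subst (m ℕ.∣_) (cong suc (ℕ.+-comm (suc j) t)) m∣
      regroup : ∀ σ f x g u → (- + 3 * σ) * (u * f) * (x * g) ≡ σ * f * ((+ 3 * x) * (- u * g))
      regroup = solve-∀

    weighted-concentrated : ∀ g I i → m ℕ.∣ g (2 ℕ.+ i) → (∀ k → suc i < k → m ℕ.∣ I k) →
      ∀ t → + weighted g I (t ℕ.+ suc i) ≈ + (I (suc i) ℕ.* ∏ g (3 ℕ.+ i) t)
    weighted-concentrated g I i m∣g I-vanishes zero = begin
      + (g (2 ℕ.+ i) ℕ.* weighted g I i ℕ.+ I (suc i))   ≈⟨ ≈-dropMultiple (ℕ.+-comm _ (I (suc i))) (ℕ.∣m⇒∣m*n _ m∣g) ⟩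
      + I (suc i)                                         ≡⟨ cong +_ (ℕ.*-identityʳ (I (suc i))) ⟨
      + (I (suc i) ℕ.* 1)                                 ∎
      where open ≈-Reasoning
    weighted-concentrated g I i m∣g I-vanishes (suc t) = begin
      + (g (2 ℕ.+ (t ℕ.+ suc i)) ℕ.* w ℕ.+ I (suc (t ℕ.+ suc i)))
        ≈⟨ ≈-dropMultiple refl (I-vanishes _ (s≤s (ℕ.m≤n+m (suc i) t))) ⟩
      + (g (2 ℕ.+ (t ℕ.+ suc i)) ℕ.* w)
        ≡⟨ ℤ.pos-* (g (2 ℕ.+ (t ℕ.+ suc i))) w ⟩
      + g (2 ℕ.+ (t ℕ.+ suc i)) * + w
        ≈⟨ *-cong (≈-refl {+ g (2 ℕ.+ (t ℕ.+ suc i))}) (weighted-concentrated g I i m∣g I-vanishes t) ⟩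
      + g (2 ℕ.+ (t ℕ.+ suc i)) * + (I (suc i) ℕ.* ∏ g (3 ℕ.+ i) t)
        ≡⟨ ℤ.pos-* (g (2 ℕ.+ (t ℕ.+ suc i))) (I (suc i) ℕ.* ∏ g (3 ℕ.+ i) t) ⟨
      + (g (2 ℕ.+ (t ℕ.+ suc i)) ℕ.* (I (suc i) ℕ.* ∏ g (3 ℕ.+ i) t))
        ≡⟨ cong +_ (rotate (g (2 ℕ.+ (t ℕ.+ suc i))) (I (suc i)) _) ⟩
      + (I (suc i) ℕ.* (∏ g (3 ℕ.+ i) t ℕ.* g (2 ℕ.+ (t ℕ.+ suc i))))
        ≡⟨ cong (λ k → + (I (suc i) ℕ.* (∏ g (3 ℕ.+ i) t ℕ.* g k))) (index i t) ⟩
      + (I (suc i) ℕ.* ∏ g (3 ℕ.+ i) (suc t))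
        ∎
      where
      open ≈-Reasoning
      w = weighted g I (t ℕ.+ suc i)
      rotate : ∀ x a c → x ℕ.* (a ℕ.* c) ≡ a ℕ.* (c ℕ.* x)
      rotate = ℕ-Solver.solve-∀
      index : ∀ i t → 2 ℕ.+ (t ℕ.+ suc i) ≡ 3 ℕ.+ i ℕ.+ t
      index = ℕ-Solver.solve-∀

  module Evaluation {m : ℕ} (p-prime : Prime (4 ℕ.+ m)) where

    open PrimeModulus p-prime
    open Progressions p
    open LinearRoots (linearRoots p-prime (s≤s (s≤s (s≤s (s≤s z≤n)))))

    n q : ℕ
    n = 2 ℕ.+ m
    q = 3 ℕ.+ m

    -- H = tri∏ 1 p * ∑_{r=1}^{p-1} 1 / (3r + 4)
    H : ℕ
    H = weighted (tri 1) (tri∏ 1) q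

    H≈-1 : + H ≈ -1ℤ
    H≈-1 = from-root 2≤k₁ p∣tri-k₁ k₁<p
      where
      from-root : ∀ {k} → 2 ≤ k → p ℕ.∣ tri 1 k → k < p → + H ≈ -1ℤ
      from-root {suc (suc i)} (s≤s (s≤s z≤n)) p∣tri-k k<p = begin
        + H                                                      ≡⟨ cong (λ l → + weighted (tri 1) (tri∏ 1) l) (sym t+1+i≡q) ⟩
        + weighted (tri 1) (tri∏ 1) (t ℕ.+ suc i)                ≈⟨ weighted-concentrated (tri 1) (tri∏ 1) i p∣tri-k vanishes t ⟩
        + (tri∏ 1 (suc i) ℕ.* ∏ (tri 1) (3 ℕ.+ i) t)             ≡⟨ ℤ.pos-* (tri∏ 1 (suc i)) _ ⟩
        + tri∏ 1 (suc i) * + ∏ (tri 1) (3 ℕ.+ i) t               ≈⟨ *-cong (∏-tri-below 1 1 (suc i) p∣tri-k) (∏-tri-above 1 (2 ℕ.+ i) t p∣tri-k) ⟩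
        (- + 3) ^ suc i * + (suc i !) * (+ (3 ℕ.^ t) * + (t !))  ≈⟨ reflect (suc i) t (ℕ.∣-reflexive (cong (2 ℕ.+_) (sym i+t≡n))) ⟩
        + (3 ℕ.^ suc (i ℕ.+ t)) * + (suc (i ℕ.+ t) !)            ≡⟨ cong (λ k → + (3 ℕ.^ suc k) * + (suc k !)) i+t≡n ⟩
        + (3 ℕ.^ q) * + (q !)                                    ≈⟨ *-cong (fermat-unit (s≤s z≤n) (s≤s (s≤s (s≤s (s≤s z≤n))))) wilson ⟩
        1ℤ * -1ℤ                                                 ≡⟨⟩
        -1ℤ                                                      ∎
        where
        open ≈-Reasoning
        i≤n : i ≤ n
        i≤n = ℕ.≤-pred (ℕ.≤-pred (ℕ.<⇒≤ k<p))
        t = n ∸ i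
        i+t≡n : i ℕ.+ t ≡ n
        i+t≡n = ℕ.m+[n∸m]≡n i≤n
        t+1+i≡q : t ℕ.+ suc i ≡ q
        t+1+i≡q = trans (ℕ.+-suc t i) (cong suc (trans (ℕ.+-comm t i) i+t≡n))
        vanishes : ∀ k → suc i < k → p ℕ.∣ tri∏ 1 k
        vanishes k 1+i<k = ℕ.∣-trans p∣tri-k (∣-∏ (tri 1) k (s≤s z≤n) (s≤s 1+i<k))

    private
      ∣m+n∣n⇒∣m : ∀ {d a b} → d ℕ.∣ a ℕ.+ b → d ℕ.∣ b → d ℕ.∣ a
      ∣m+n∣n⇒∣m {d} {a} {b} d∣a+b d∣b = ℕ.∣m+n∣m⇒∣n (subst (d ℕ.∣_) (ℕ.+-comm a b) d∣a+b) d∣b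

      ∣-∏-tri : ∀ s {k} i l → p ℕ.∣ tri s k → i ≤ k → k < i ℕ.+ l → p ℕ.∣ ∏ (tri s) i l
      ∣-∏-tri s i l p∣tri i≤k k<i+l = ℕ.∣-trans p∣tri (∣-∏ (tri s) l i≤k k<i+l)

      p∣tri∏₁ : p ℕ.∣ tri∏ 1 p
      p∣tri∏₁ = ∣-∏-tri 1 1 p p∣tri-k₁ (ℕ.≤-trans (s≤s z≤n) 2≤k₁) (ℕ.m<n⇒m<1+n k₁<p)

      p∣∏₁ : p ℕ.∣ ∏ (tri 1) 2 q
      p∣∏₁ = ∣-∏-tri 1 2 q p∣tri-k₁ 2≤k₁ (ℕ.m<n⇒m<1+n k₁<p)

      p∣tri∏₂ : p ℕ.∣ tri∏ 2 p
      p∣tri∏₂ = ∣-∏-tri 2 1 p p∣tri-k₂ 1≤k₂ (ℕ.m<n⇒m<1+n k₂<p)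

      p∣tri∏₃ : p ℕ.∣ tri∏ 3 p
      p∣tri∏₃ = ∣-∏-tri 3 1 p (ℕ.divides 3 (tri-3q m)) (s≤s z≤n) (ℕ.m<n⇒m<1+n (ℕ.n<1+n q))
        where
        tri-3q : ∀ m → 3 ℕ.* (3 ℕ.+ m) ℕ.+ 3 ≡ 3 ℕ.* (4 ℕ.+ m)
        tri-3q = ℕ-Solver.solve-∀

      p∣weighted₂ : p ℕ.∣ 1 ℕ.* weighted (tri 1) (tri∏ 2) q
      p∣weighted₂ = ∣m+n∣n⇒∣m (subst (p ℕ.∣_) (sym (weighted-tri∏ 1 q)) p∣tri∏₂) (ℕ.∣n⇒∣m*n 5 p∣∏₁)

      p∣weighted₃ : p ℕ.∣ 2 ℕ.* weighted (tri 1) (tri∏ 3) q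
      p∣weighted₃ = ∣m+n∣n⇒∣m (subst (p ℕ.∣_) (sym (weighted-tri∏ 2 q)) p∣tri∏₃) (ℕ.∣n⇒∣m*n 6 p∣∏₁)

    p∣2Γ+4H : p ℕ.∣ 2 ℕ.* Γ p ℕ.+ 4 ℕ.* H
    p∣2Γ+4H = ℕ.∣m+n∣m⇒∣n (subst (p ℕ.∣_) regrouped p∣sum) (ℕ.∣m∣n⇒∣m+n (ℕ.∣n⇒∣m*n 2 p∣weighted₂) p∣weighted₃)
      where
      W₂ = weighted (tri 1) bracket₂ q
      W₃ = weighted (tri 1) bracket₃ q
      P₂ = weighted (tri 1) (tri∏ 2) q
      P₃ = weighted (tri 1) (tri∏ 3) q
      p∣sum : p ℕ.∣ 2 ℕ.* (W₂ ℕ.+ P₂ ℕ.+ H) ℕ.+ 2 ℕ.* (W₃ ℕ.+ P₃ ℕ.+ H)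
      p∣sum = ℕ.∣m∣n⇒∣m+n
        (subst (p ℕ.∣_) (sym (weighted-bracket₂ q)) (ℕ.∣n⇒∣m*n q p∣tri∏₁))
        (ℕ.∣n⇒∣m*n 2 (subst (p ℕ.∣_) (sym (weighted-bracket₃ q)) (ℕ.∣n⇒∣m*n q p∣tri∏₁)))
      regroup : ∀ w₂ w₃ p₂ p₃ h → 2 ℕ.* (w₂ ℕ.+ p₂ ℕ.+ h) ℕ.+ 2 ℕ.* (w₃ ℕ.+ p₃ ℕ.+ h)
                                ≡ 2 ℕ.* (1 ℕ.* p₂) ℕ.+ 2 ℕ.* p₃ ℕ.+ (2 ℕ.* (w₂ ℕ.+ w₃) ℕ.+ 4 ℕ.* h)
      regroup = ℕ-Solver.solve-∀
      regrouped : 2 ℕ.* (W₂ ℕ.+ P₂ ℕ.+ H) ℕ.+ 2 ℕ.* (W₃ ℕ.+ P₃ ℕ.+ H)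
                  ≡ 2 ℕ.* (1 ℕ.* P₂) ℕ.+ 2 ℕ.* P₃ ℕ.+ (2 ℕ.* Γ p ℕ.+ 4 ℕ.* H)
      regrouped = trans (regroup W₂ W₃ P₂ P₃ H)
        (cong (λ g → 2 ℕ.* (1 ℕ.* P₂) ℕ.+ 2 ℕ.* P₃ ℕ.+ (2 ℕ.* g ℕ.+ 4 ℕ.* H)) (sym (Γ-split q)))

    Γ≈2 : + Γ p ≈ + 2
    Γ≈2 = ≈-cancelˡ (+ 2) (∤-unit (s≤s z≤n) (s≤s (s≤s (s≤s z≤n)))) (begin
      + 2 * + Γ p                              ≡⟨ shuffle (+ Γ p) (+ H) ⟩
      (+ 2 * + Γ p + + 4 * + H) - + 4 * + H    ≡⟨ cong (_- + 4 * + H) (sym cast) ⟩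
      + (2 ℕ.* Γ p ℕ.+ 4 ℕ.* H) - + 4 * + H    ≈⟨ +-cong (∣ℕ⇒≈0 p∣2Γ+4H) (-‿cong (*-cong (≈-refl {+ 4}) H≈-1)) ⟩
      0ℤ - + 4 * -1ℤ                           ≡⟨⟩
      + 2 * + 2                                ∎)
      where
      open ≈-Reasoning
      cast : + (2 ℕ.* Γ p ℕ.+ 4 ℕ.* H) ≡ + 2 * + Γ p + + 4 * + H
      cast = trans (ℤ.pos-+ (2 ℕ.* Γ p) (4 ℕ.* H)) (cong₂ _+_ (ℤ.pos-* 2 (Γ p)) (ℤ.pos-* 4 H))
      shuffle : ∀ g h → + 2 * g ≡ (+ 2 * g + + 4 * h) - + 4 * h
      shuffle = solve-∀

open import Data.Nat using (ℕ; suc; s≤s; _>_)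
open import Data.Nat.Divisibility using (∣1⇒≡1)
open import Data.Nat.Primality using (Prime)
open import Data.Integer using (+_; _-_; _*_)
open import Data.Integer.Divisibility using (_∣_)
open import Data.Integer.Divisibility.Signed using (∣⇒∣ᵤ)
open import Data.Rational using (↥_; ↧_)
open import Data.Product using (_×_; _,_)
open import Relation.Nullary using (¬_; contradiction)
open import Relation.Binary.PropositionalEquality using (subst; sym; trans)
open WeightedSums using (Γ)
open RationalForm using (γ≡ιΓ; ι≡mkℚ)
open Modular using (module Congruence; module Evaluation)

proposition3 : (p : ℕ) → Prime p → p > 3 →
    (¬ (+ p ∣ ↧ (γ p)))
      × (+ p ∣ (↥ (γ p) - + 2 * ↧ (γ p)))
proposition3 p@(suc (suc (suc (suc m)))) p-prime (s≤s (s≤s (s≤s (s≤s _)))) =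
  subst (λ x → (¬ (+ p ∣ ↧ x)) × (+ p ∣ (↥ x - + 2 * ↧ x))) (sym (trans (γ≡ιΓ p) (ι≡mkℚ (Γ p))))
    ((λ p∣1 → contradiction (∣1⇒≡1 p∣1) λ ()) , ∣⇒∣ᵤ (Congruence._≈_.m∣x-y (Evaluation.Γ≈2 p-prime)))
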